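{- Recent-proof compatibility implies low update frequency. Precisely: suppose a commitment scheme for an append-only list has recent-proof compatibility with parameter $c>0$. Let $1\le i\le m$ and $k\ge1$, and consider a participant who holds the membership proof $\pi_{x_i\in X_m}$ at state $X_m$ and, during the states $X_{m+1},\dots,X_{m+k}$, replaces their held proof by the current proof $\pi_{x_i\in X_{n}}$ exactly at those states $X_n$ at which the held proof is not valid against the current commitment $\langle X_n\rangle$. Then the number of such replacements is bounded by a function of $k$ alone (independent of $m$ and $i$) that is sublinear in $k$.
   Context: An append-only list $X=(x_1,x_2,\dots)$ has states $X_n=(x_1,\dots,x_n)$. A commitment scheme assigns to each state a commitment $\langle X_n\rangle$ and to each $i\le n$ a membership proof $\pi_{x_i\in X_n}$, which can be checked (valid or not) against any commitment $\langle X_m\rangle$. Recent-proof compatibility with parameter $c>0$: for all $i\le n\le m\le n+c(n-i+1)$, the proof $\pi_{x_i\in X_n}$ is valid against $\langle X_m\rangle$. Low update frequency: during any $k$-increment (passage from $X_m$ to $X_{m+k}$), any membership proof needs to be updated a number of times sublinear in $k$.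
   Formalization: The recent-proof compatibility parameter c ranges over the positive rationals. -}

module Defs where

open import Data.Nat using (ℕ; zero; suc; _≤_; _∸_)
open import Data.Bool using (Bool; true; false; if_then_else_)
open import Data.List using (List; []; _∷_; _++_)
open import Data.Integer using (+_)
open import Data.Rational using (ℚ; _/_; _+_; _*_) renaming (_≤_ to _≤ℚ_; _<_ to _<ℚ_)
open import Data.Rational using (0ℚ)
open import Data.Product using (∃)
open import Relation.Binary.PropositionalEquality using (_≡_)

ℕ→ℚ : ℕ → ℚ
ℕ→ℚ n = + n / 1

-- A commitment scheme for append-only lists over an element type E.
-- commit xs   : the commitment ⟨xs⟩ to the state xs
-- prove xs i  : the membership proof π_{x_i ∈ xs} (i is 1-based, meaningful for 1 ≤ i ≤ length xs)
-- verify p C  : whether proof p is valid against commitment C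
record Scheme (E : Set) : Set₁ where
  field
    Com    : Set
    Proof  : Set
    commit : List E → Com
    prove  : List E → ℕ → Proof
    verify : Proof → Com → Bool

-- The states of the append-only list x = (x 1, x 2, …): X n = (x 1, …, x n).
-- (x 0 is never used.)
state : {E : Set} → (ℕ → E) → ℕ → List E
state x zero    = []
state x (suc n) = state x n ++ (x (suc n) ∷ [])

RecentProofCompatible : {E : Set} → Scheme E → (ℕ → E) → ℚ → Set
RecentProofCompatible S x c =
  ∀ (i n m : ℕ) → 1 ≤ i → i ≤ n → n ≤ m →
  ℕ→ℚ m ≤ℚ ℕ→ℚ n + c * ℕ→ℚ (suc (n ∸ i)) →
  Scheme.verify S (Scheme.prove S (state x n) i) (Scheme.commit S (state x m)) ≡ true

replacements : {E : Set} → (S : Scheme E) → (ℕ → E) → ℕ →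
               Scheme.Proof S → ℕ → ℕ → ℕ
replacements S x i h n zero = zero
replacements S x i h n (suc s) =
  if Scheme.verify S h (Scheme.commit S (state x (suc n)))
  then replacements S x i h (suc n) s
  else suc (replacements S x i (Scheme.prove S (state x (suc n)) i) (suc n) s)

updateCount : {E : Set} → Scheme E → (ℕ → E) → (i m k : ℕ) → ℕ
updateCount S x i m k = replacements S x i (Scheme.prove S (state x m) i) m k

Sublinear : (ℕ → ℕ) → Set
Sublinear f = ∀ (ε : ℚ) → 0ℚ <ℚ ε → ∃ λ K → ∀ k → K ≤ k → ℕ→ℚ (f k) ≤ℚ ε * ℕ→ℚ k

-- With c ≥ 1/q, the proof π_{x_i ∈ X_n} stays valid for (n − i + 1)/q further states.
-- The proof held before the r-th replacement was issued at a state n ≥ i + r − 2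
-- (initially n = m ≥ i, and each replacement moves to a strictly later state), so it
-- is replaced only after at least r/q states. Hence R replacements within k states
-- force 1 + 2 + ⋯ + R ≤ q k, that is R ≤ √(2 q k), which is sublinear in k.
module Submission where

open import Defs
open import Data.Nat using (ℕ; _≤_)
open import Data.Rational using (ℚ; 0ℚ; _<_)
open import Data.Product using (Σ; _×_)

open import Data.Nat using (zero; suc; _+_; _*_; _∸_; z≤n; s≤s; _≤?_)
open import Data.Nat.Properties
open import Data.Nat.Tactic.RingSolver using (solve)
open import Data.Nat.Coprimality using (1-coprimeTo) renaming (sym to coprime-sym)
open import Data.Integer as ℤ using (+_; +≤+; +<+; -[1+_])
import Data.Integer.Properties as ℤ
open import Data.Rational as ℚ using (mkℚ; toℚᵘ)
open import Data.Rational.Properties as ℚ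
  using (↥p/↧p≡p; toℚᵘ-cong; toℚᵘ-injective; toℚᵘ-cancel-≤; toℚᵘ-homo-+; toℚᵘ-homo-*)
open import Data.Rational.Unnormalised as ℚᵘ using (mkℚᵘ; *≡*; *≤*)
import Data.Rational.Unnormalised.Properties as ℚᵘ
open import Data.Product using (_,_; ∃-syntax)
open import Data.Bool using (true; false)
open import Data.List using (_∷_; [])
open import Data.Sum using (inj₁; inj₂)
open import Relation.Nullary using (yes; no; ¬_; contradiction)
open import Relation.Binary.PropositionalEquality

toℚᵘ-ℕ→ℚ : ∀ n → toℚᵘ (ℕ→ℚ n) ℚᵘ.≃ mkℚᵘ (+ n) 0
toℚᵘ-ℕ→ℚ n = toℚᵘ-cong (↥p/↧p≡p (mkℚ (+ n) 0 (coprime-sym (1-coprimeTo n))))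

ℕ→ℚ-homo-+ : ∀ m n → ℕ→ℚ (m + n) ≡ ℕ→ℚ m ℚ.+ ℕ→ℚ n
ℕ→ℚ-homo-+ m n = toℚᵘ-injective (begin
  toℚᵘ (ℕ→ℚ (m + n))                    ≈⟨ toℚᵘ-ℕ→ℚ (m + n) ⟩
  mkℚᵘ (+ (m + n)) 0                     ≈⟨ *≡* (cong (ℤ._* + 1) numerator) ⟩
  mkℚᵘ (+ m) 0 ℚᵘ.+ mkℚᵘ (+ n) 0        ≈⟨ ℚᵘ.+-cong (toℚᵘ-ℕ→ℚ m) (toℚᵘ-ℕ→ℚ n) ⟨
  toℚᵘ (ℕ→ℚ m) ℚᵘ.+ toℚᵘ (ℕ→ℚ n)       ≈⟨ toℚᵘ-homo-+ (ℕ→ℚ m) (ℕ→ℚ n) ⟨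
  toℚᵘ (ℕ→ℚ m ℚ.+ ℕ→ℚ n)               ∎)
  where
  open ℚᵘ.≃-Reasoning
  numerator : + (m + n) ≡ + m ℤ.* + 1 ℤ.+ + n ℤ.* + 1
  numerator = trans (ℤ.pos-+ m n) (sym (cong₂ ℤ._+_ (ℤ.*-identityʳ (+ m)) (ℤ.*-identityʳ (+ n))))

-- A positive c = (a + 1)/(b + 1) is at least 1/(b + 1).
ℕ→ℚ-≤-*-positive : ∀ c → 0ℚ < c → ∃[ q ] ∀ t d → t * suc q ≤ d → ℕ→ℚ t ℚ.≤ c ℚ.* ℕ→ℚ d
ℕ→ℚ-≤-*-positive (mkℚ (+ zero) _ _)   (ℚ.*<* (+<+ ()))
ℕ→ℚ-≤-*-positive (mkℚ -[1+ _ ] _ _)   (ℚ.*<* ())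
ℕ→ℚ-≤-*-positive c@(mkℚ (+ suc a) b _) _ = b , λ t d t*q≤d → toℚᵘ-cancel-≤ (unnormalised t d t*q≤d)
  where
  cross : ∀ t d → t * suc b ≤ d → + t ℤ.* + suc (b * 1) ℤ.≤ (+ suc a ℤ.* + d) ℤ.* + 1
  cross t d t*q≤d = begin
    + t ℤ.* + suc (b * 1)     ≡⟨ cong (λ e → + t ℤ.* + suc e) (*-identityʳ b) ⟩
    + t ℤ.* + suc b           ≡⟨ ℤ.pos-* t (suc b) ⟨
    + (t * suc b)             ≤⟨ +≤+ (≤-trans t*q≤d (m≤n*m d (suc a))) ⟩
    + (suc a * d)             ≡⟨ ℤ.pos-* (suc a) d ⟩
    + suc a ℤ.* + d           ≡⟨ ℤ.*-identityʳ _ ⟨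
    (+ suc a ℤ.* + d) ℤ.* + 1 ∎
    where open ℤ.≤-Reasoning
  unnormalised : ∀ t d → t * suc b ≤ d → toℚᵘ (ℕ→ℚ t) ℚᵘ.≤ toℚᵘ (c ℚ.* ℕ→ℚ d)
  unnormalised t d t*q≤d = begin
    toℚᵘ (ℕ→ℚ t)                         ≃⟨ toℚᵘ-ℕ→ℚ t ⟩
    mkℚᵘ (+ t) 0                          ≤⟨ *≤* (cross t d t*q≤d) ⟩
    mkℚᵘ (+ suc a) b ℚᵘ.* mkℚᵘ (+ d) 0   ≃⟨ ℚᵘ.*-congˡ {toℚᵘ c} (toℚᵘ-ℕ→ℚ d) ⟨
    toℚᵘ c ℚᵘ.* toℚᵘ (ℕ→ℚ d)             ≃⟨ toℚᵘ-homo-* c (ℕ→ℚ d) ⟨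
    toℚᵘ (c ℚ.* ℕ→ℚ d)                   ∎
    where open ℚᵘ.≤-Reasoning

1+[n∸i]≤1+m∸i : ∀ {i n m} → i ≤ n → n ≤ m → suc (n ∸ i) ≤ suc m ∸ i
1+[n∸i]≤1+m∸i {i} {n} {m} i≤n n≤m = begin
  suc (n ∸ i) ≤⟨ s≤s (∸-monoˡ-≤ i n≤m) ⟩
  suc (m ∸ i) ≡⟨ +-∸-assoc 1 (≤-trans i≤n n≤m) ⟨
  suc m ∸ i   ∎
  where open ≤-Reasoning

m*m≤n*n⇒m≤n : ∀ {m n} → m * m ≤ n * n → m ≤ n
m*m≤n*n⇒m≤n m*m≤n*n = ≮⇒≥ (λ n<m → <⇒≱ (*-mono-< n<m n<m) m*m≤n*n)

maxRoot : ℕ → ℕ → ℕ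
maxRoot n zero = zero
maxRoot n (suc r) with suc r * suc r ≤? n
... | yes _ = suc r
... | no  _ = maxRoot n r

maxRoot-square-≤ : ∀ n r → maxRoot n r * maxRoot n r ≤ n
maxRoot-square-≤ n zero = z≤n
maxRoot-square-≤ n (suc r) with suc r * suc r ≤? n
... | yes r²≤n = r²≤n
... | no  _    = maxRoot-square-≤ n r

≤-maxRoot : ∀ {n r s} → s ≤ r → s * s ≤ n → s ≤ maxRoot n r
≤-maxRoot {r = zero} z≤n _ = z≤n
≤-maxRoot {n} {suc r} s≤r s²≤n with suc r * suc r ≤? n
... | yes _ = s≤r
... | no r²≰n with m≤n⇒m<n∨m≡n s≤r
...   | inj₁ (s≤s s≤r′) = ≤-maxRoot s≤r′ s²≤n
...   | inj₂ refl       = contradiction s²≤n r²≰n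

⌊√_⌋ : ℕ → ℕ
⌊√ n ⌋ = maxRoot n n

⌊√⌋-square-≤ : ∀ n → ⌊√ n ⌋ * ⌊√ n ⌋ ≤ n
⌊√⌋-square-≤ n = maxRoot-square-≤ n n

square-≤⇒≤⌊√⌋ : ∀ {n s} → s * s ≤ n → s ≤ ⌊√ n ⌋
square-≤⇒≤⌊√⌋ {s = zero}  _    = z≤n
square-≤⇒≤⌊√⌋ {s = suc s} s²≤n = ≤-maxRoot (≤-trans (m≤m*n (suc s) (suc s)) s²≤n) s²≤n

√-sublinear : ∀ C → Sublinear (λ k → ⌊√ (k * C) ⌋)
√-sublinear C ε 0<ε with ℕ→ℚ-≤-*-positive ε 0<ε
... | q , scale = C * (suc q * suc q) , λ k K≤k → scale ⌊√ (k * C) ⌋ k (m*m≤n*n⇒m≤n (squares k K≤k))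
  where
  squares : ∀ k → C * (suc q * suc q) ≤ k →
            (⌊√ (k * C) ⌋ * suc q) * (⌊√ (k * C) ⌋ * suc q) ≤ k * k
  squares k K≤k = begin
    (r * suc q) * (r * suc q) ≡⟨ [m*n]*[o*p]≡[m*o]*[n*p] r (suc q) r (suc q) ⟩
    (r * r) * (suc q * suc q) ≤⟨ *-monoˡ-≤ (suc q * suc q) (⌊√⌋-square-≤ (k * C)) ⟩
    (k * C) * (suc q * suc q) ≡⟨ *-assoc k C (suc q * suc q) ⟩
    k * (C * (suc q * suc q)) ≤⟨ *-monoʳ-≤ k K≤k ⟩
    k * k                     ∎
    where
    open ≤-Reasoning
    r = ⌊√ (k * C) ⌋

-- Recent-proof compatibility with parameter 1/q, restated over ℕ.
StaysValid : {E : Set} → Scheme E → (ℕ → E) → ℕ → Set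
StaysValid S x q = ∀ i n t → 1 ≤ i → i ≤ n → t * q ≤ suc (n ∸ i) →
  Scheme.verify S (Scheme.prove S (state x n) i) (Scheme.commit S (state x (t + n))) ≡ true

recentProofCompatible⇒staysValid : {E : Set} (S : Scheme E) (x : ℕ → E) (c : ℚ) → 0ℚ < c →
  RecentProofCompatible S x c → ∃[ q ] StaysValid S x q
recentProofCompatible⇒staysValid S x c 0<c rpc with ℕ→ℚ-≤-*-positive c 0<c
... | q , scale = suc q , λ i n t 1≤i i≤n t*q≤age → rpc i n (t + n) 1≤i i≤n (m≤n+m n t) (begin
  ℕ→ℚ (t + n)                           ≡⟨ ℕ→ℚ-homo-+ t n ⟩
  ℕ→ℚ t ℚ.+ ℕ→ℚ n                       ≤⟨ ℚ.+-monoˡ-≤ (ℕ→ℚ n) (scale t _ t*q≤age) ⟩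
  c ℚ.* ℕ→ℚ (suc (n ∸ i)) ℚ.+ ℕ→ℚ n     ≡⟨ ℚ.+-comm _ (ℕ→ℚ n) ⟩
  ℕ→ℚ n ℚ.+ c ℚ.* ℕ→ℚ (suc (n ∸ i))     ∎)
  where open ℚ.≤-Reasoning

sumFrom : ℕ → ℕ → ℕ
sumFrom j zero    = zero
sumFrom j (suc r) = suc j + sumFrom (suc j) r

sumFrom-gauss : ∀ j r → 2 * sumFrom j r ≡ r * (2 * j + suc r)
sumFrom-gauss j zero    = refl
sumFrom-gauss j (suc r) = begin
  2 * (suc j + sumFrom (suc j) r)         ≡⟨ *-distribˡ-+ 2 (suc j) _ ⟩
  2 * suc j + 2 * sumFrom (suc j) r       ≡⟨ cong (λ s → 2 * suc j + s) (sumFrom-gauss (suc j) r) ⟩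
  2 * suc j + r * (2 * suc j + suc r)     ≡⟨ solve (j ∷ r ∷ []) ⟩
  suc r * (2 * j + suc (suc r))           ∎
  where open ≡-Reasoning

module _ {E : Set} (S : Scheme E) (x : ℕ → E) {q : ℕ} (valid : StaysValid S x q) where
  open Scheme S

  -- j is a lower bound for the age n − i + 1 of the held proof; it grows by one with each replacement.
  replacements-cost : ∀ {i} → 1 ≤ i → ∀ s n t j → i ≤ n → j ≤ suc (n ∸ i) →
    sumFrom j (replacements S x i (prove (state x n) i) (t + n) s) ≤ (t + s) * q
  replacements-cost 1≤i zero n t j _ _ = z≤n
  replacements-cost {i} 1≤i (suc s) n t j i≤n j≤age
    with verify (prove (state x n) i) (commit (state x (suc t + n))) in held
  ... | true = ≤-trans (replacements-cost 1≤i s n (suc t) j i≤n j≤age)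
                       (≤-reflexive (cong (_* q) (sym (+-suc t s))))
  ... | false = begin
    suc j + sumFrom (suc j) R ≤⟨ +-mono-≤ gap (replacements-cost 1≤i s (suc t + n) 0 (suc j) i≤n′ age′) ⟩
    suc t * q + s * q         ≡⟨ *-distribʳ-+ q (suc t) s ⟨
    (suc t + s) * q           ≡⟨ cong (_* q) (+-suc t s) ⟨
    (t + suc s) * q           ∎
    where
    open ≤-Reasoning
    R = replacements S x i (prove (state x (suc t + n)) i) (suc t + n) s
    i≤n′ : i ≤ suc t + n
    i≤n′ = ≤-trans i≤n (m≤n+m n (suc t))
    age′ : suc j ≤ suc (suc t + n ∸ i)
    age′ = s≤s (≤-trans j≤age (1+[n∸i]≤1+m∸i i≤n (m≤n+m n t)))
    expired : ¬ (suc t * q ≤ suc (n ∸ i))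
    expired short with trans (sym (valid i n (suc t) 1≤i i≤n short)) held
    ... | ()
    gap : suc j ≤ suc t * q
    gap = ≤-<-trans j≤age (≰⇒> expired)

  updateCount-square-≤ : ∀ {i m} → 1 ≤ i → i ≤ m → ∀ k →
    updateCount S x i m k * updateCount S x i m k ≤ k * (2 * q)
  updateCount-square-≤ {i} {m} 1≤i i≤m k = begin
    R * R           ≤⟨ *-monoʳ-≤ R (n≤1+n R) ⟩
    R * suc R       ≡⟨ sumFrom-gauss 0 R ⟨
    2 * sumFrom 0 R ≤⟨ *-monoʳ-≤ 2 (replacements-cost 1≤i k m 0 0 i≤m z≤n) ⟩
    2 * (k * q)     ≡⟨ solve (k ∷ q ∷ []) ⟩
    k * (2 * q)     ∎
    where
    open ≤-Reasoning
    R = updateCount S x i m k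

lemma7 : {E : Set} (S : Scheme E) (x : ℕ → E) (c : ℚ) → 0ℚ < c →
    RecentProofCompatible S x c →
    Σ (ℕ → ℕ) λ f → Sublinear f ×
      (∀ (i m k : ℕ) → 1 ≤ i → i ≤ m → 1 ≤ k → updateCount S x i m k ≤ f k)
lemma7 S x c 0<c rpc with recentProofCompatible⇒staysValid S x c 0<c rpc
... | q , valid = (λ k → ⌊√ (k * (2 * q)) ⌋) , √-sublinear (2 * q) ,
  λ i m k 1≤i i≤m _ → square-≤⇒≤⌊√⌋ (updateCount-square-≤ S x valid 1≤i i≤m k)
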